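{- Let $n$ and $k$ be integers with $3\le k\le n-1$, and let $U_{n,k}$ be any connected unicyclic graph of order $n$ whose unique cycle has length $k$. Then the eigenvalues of the path matrix $P(U_{n,k})$, listed with multiplicities, are $-2$ with multiplicity $k-1$, $-1$ with multiplicity $n-k-1$, and the two simple values $$\rho_{1,2}=\frac{n+k-3\pm\sqrt{(n+k-3)^2+4(k^2-nk+2n-2)}}{2}.$$
   Context: For a simple graph $G$ with vertex set $\{v_1,\dots,v_n\}$, the path matrix $P(G)=(p_{ij})$ is the $n\times n$ matrix with $p_{ij}$ equal to the maximum number of internally vertex-disjoint paths between $v_i$ and $v_j$ for $i\neq j$, and $p_{ii}=0$. A unicyclic graph is a connected graph containing exactly one cycle. -}

module Defs where

open import Data.Nat as ℕ using (ℕ; zero; suc; _≤_)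
open import Data.Integer as ℤ using (ℤ; +_; -_; _+_; _*_; _-_)
open import Data.Fin using (Fin; zero; suc; punchIn)
open import Data.List using (List; []; _∷_; _++_; [_])
open import Data.List.Relation.Unary.Linked using (Linked)
open import Data.List.Relation.Unary.Unique.Propositional using (Unique)
open import Data.List.Membership.Propositional using (_∈_; _∉_)
open import Data.Product using (Σ; _×_; ∃; ∃-syntax)
open import Data.Sum using (_⊎_)
open import Relation.Nullary using (¬_)
open import Relation.Binary.PropositionalEquality using (_≡_; _≢_)
open import Relation.Binary.Definitions using (Decidable)

record Graph (n : ℕ) : Set₁ where
  field
    Adj    : Fin n → Fin n → Set
    adj?   : Decidable Adj
    sym    : ∀ {u v} → Adj u v → Adj v u
    irrefl : ∀ u → ¬ Adj u u
open Graph public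

module _ {n : ℕ} (G : Graph n) where

  IsWalk : List (Fin n) → Set
  IsWalk = Linked (Adj G)

  Connected : Set
  Connected = ∀ u v → u ≢ v → ∃[ ws ] IsWalk (u ∷ ws ++ [ v ])

  IsPath : Fin n → Fin n → List (Fin n) → Set
  IsPath u v ws = IsWalk (u ∷ ws ++ [ v ]) × Unique (u ∷ ws ++ [ v ])

  HasDisjointPaths : Fin n → Fin n → ℕ → Set
  HasDisjointPaths u v m =
    Σ (Fin m → List (Fin n)) λ ws →
      (∀ i → IsPath u v (ws i)) ×
      (∀ i j → i ≢ j → (ws i ≢ ws j) × (∀ x → x ∈ ws i → x ∉ ws j))

  IsPathMatrix : (Fin n → Fin n → ℕ) → Set
  IsPathMatrix M = ∀ i j →
    (i ≡ j → M i j ≡ 0) ×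
    (i ≢ j → HasDisjointPaths i j (M i j)
             × (∀ m → HasDisjointPaths i j m → m ≤ M i j))

  IsCycle : Fin n → List (Fin n) → Set
  IsCycle c cs = (2 ≤ Data.List.length cs) × IsWalk (c ∷ cs ++ [ c ]) × Unique (c ∷ cs)

data Consec {A : Set} : List A → A → A → Set where
  here  : ∀ {x y xs} → Consec (x ∷ y ∷ xs) x y
  there : ∀ {x xs a b} → Consec xs a b → Consec (x ∷ xs) a b

CycleEdge : ∀ {n} → Fin n → List (Fin n) → Fin n → Fin n → Set
CycleEdge c cs a b = Consec (c ∷ cs ++ [ c ]) a b ⊎ Consec (c ∷ cs ++ [ c ]) b a

module _ {n : ℕ} (G : Graph n) where
  -- G is connected and contains exactly one cycle (as a subgraph, i.e.
  -- any two cycles have the same edge set), and this cycle has length k.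
  UnicyclicWithCycleLength : ℕ → Set
  UnicyclicWithCycleLength k =
    Connected G ×
    (∃[ c ] ∃[ cs ] IsCycle G c cs × suc (Data.List.length cs) ≡ k) ×
    (∀ c cs d ds → IsCycle G c cs → IsCycle G d ds →
        ∀ a b → (CycleEdge c cs a b → CycleEdge d ds a b)
              × (CycleEdge d ds a b → CycleEdge c cs a b))

sgn : ℕ → ℤ
sgn zero    = + 1
sgn (suc m) = - sgn m

sumFin : ∀ n → (Fin n → ℤ) → ℤ
sumFin zero    f = + 0
sumFin (suc n) f = f zero + sumFin n (λ i → f (suc i))

det : ∀ n → (Fin n → Fin n → ℤ) → ℤ
det zero    A = + 1
det (suc n) A = sumFin (suc n) λ j →
  sgn (Data.Fin.toℕ j) * A zero j * det n (λ r c → A (suc r) (punchIn j c))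

charMat : ∀ n → ℤ → (Fin n → Fin n → ℕ) → Fin n → Fin n → ℤ
charMat n x M i j with i Data.Fin.≟ j
... | Relation.Nullary.yes _ = x - + M i j
... | Relation.Nullary.no  _ = - (+ M i j)

{-# OPTIONS --safe #-}
module Submission where

-- In a unicyclic graph two distinct vertices are joined by two internally disjoint paths
-- exactly when both lie on the cycle (its two arcs), never by three (two of them would close
-- up two different cycles), and always by one.  So off the diagonal P(G) is 1 + [i and j both
-- lie on the cycle], and x·I − P(G) is a diagonal matrix plus a matrix with only two distinct
-- rows.  Expanding the determinant row by row, any three of those rows contain two equal ones;
-- the resulting recursion only sees the numbers k and t = n − k of vertices on and off the
-- cycle, and with p = x + 2, q = x + 1 it is solved by
--   p^k q^t − 2 k p^(k−1) q^t − t p^k q^(t−1) + k t p^(k−1) q^(t−1),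
-- which factors as p^(k−1) q^(t−1) (x² − (n+k−3) x − (k² − nk + 2n − 2)).

open import Defs renaming (sym to Adj-sym)
open import Data.Nat using (ℕ; zero; suc; _≤_; _<_; _∸_; z≤n; s≤s; _≤?_)
open import Data.Nat.Properties
  using (suc-injective; ≤-antisym; ≰⇒>; ≤-trans; <⇒≤; m<n⇒0<n∸m; m+[n∸m]≡n)
import Data.Nat as ℕ
open import Data.Integer using (ℤ; +_; -_; -[1+_]; _+_; _*_; _-_; _^_)
open import Data.Integer.Properties
  using ( +-*-semiring; +-identityˡ; +-identityʳ; *-identityˡ; *-identityʳ; *-zeroˡ; *-zeroʳ
        ; *-distribˡ-+; *-distribʳ-+; neg-distrib-+; neg-distribʳ-*; neg-involutive)
open import Data.Integer.Tactic.RingSolver using (solve-∀)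
open import Algebra.Properties.Semiring.Sum +-*-semiring
  using (sum; sum-cong-≗; sum-replicate-zero; ∑-distrib-+; ∑-comm; sum-remove; *-distribˡ-sum)
open import Data.Bool using (Bool; true; false; _∨_; if_then_else_)
open import Data.Fin using (Fin; zero; suc; _≟_; toℕ; punchIn; punchOut; inject≤)
open import Data.Fin.Properties using (punchInᵢ≢i; punchOut-punchIn; punchOut-cong; inject≤-injective)
import Data.Fin.Properties as Fin
open import Data.Fin.Subset using (Subset; ∣_∣; ∁) renaming (⊥ to ∅)
open import Data.Fin.Subset.Properties using (∣⊥∣≡0; ∣∁p∣≡n∸∣p∣)
open import Data.Vec using ([]; _∷_; head; lookup; tabulate)
open import Data.Vec.Properties using (tabulate-cong; lookup∘tabulate; lookup-replicate; tabulate∘lookup)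
open import Data.List using (List; []; _∷_; _++_; [_]; reverse; length)
open import Data.List.Properties using (++-assoc; unfold-reverse; reverse-++; length-reverse)
open import Data.List.Membership.Propositional using (_∈_; _∉_)
open import Data.List.Membership.Propositional.Properties using (∈-++⁻; ∈-++⁺ˡ; ∈-++⁺ʳ; ∈-∃++)
open import Data.List.Relation.Unary.Any using (here; there)
open import Data.List.Relation.Unary.Any.Properties using (reverse⁻)
import Data.List.Relation.Unary.All as All
open import Data.List.Relation.Unary.All using ([]; _∷_)
open import Data.List.Relation.Unary.All.Properties using (++⁻ˡ; ¬Any⇒All¬)
open import Data.List.Relation.Unary.AllPairs using ([]; _∷_)
import Data.List.Relation.Unary.AllPairs as AllPairs
open import Data.List.Relation.Unary.Linked using (Linked; []; [-]; _∷_)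
open import Data.List.Relation.Unary.Unique.Propositional using (Unique)
open import Data.List.Relation.Unary.Unique.Propositional.Properties using (Unique[x∷xs]⇒x∉xs)
import Data.List.Relation.Unary.Unique.Propositional.Properties as Unique
open import Data.List.Relation.Binary.Permutation.Propositional using (_↭_; ↭-sym; ↭⇒↭ₛ)
open import Data.List.Relation.Binary.Permutation.Propositional.Properties
  using (++-comm; ↭-length; ↭-reverse; ∈-resp-↭)
import Data.List.Relation.Binary.Permutation.Setoid.Properties as PermutationS
open import Data.Product using (_×_; _,_; proj₁; proj₂; ∃-syntax)
open import Data.Sum using (_⊎_; inj₁; inj₂)
open import Data.Empty using (⊥; ⊥-elim)
open import Function using (_∘_; id; case_of_)
open import Relation.Nullary using (¬_; yes; no; does)
open import Relation.Nullary.Decidable using (dec-true; dec-false)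
open import Relation.Binary.Core using (Rel)
open import Relation.Binary.Definitions using (Symmetric)
open import Relation.Binary.PropositionalEquality
  using (_≡_; _≢_; refl; sym; trans; cong; cong₂; subst; setoid; module ≡-Reasoning)

-- Determinants

Matrix : ℕ → Set
Matrix n = Fin n → Fin n → ℤ

minor : ∀ {n} → Matrix (suc n) → Fin (suc n) → Matrix n
minor A j r c = A (suc r) (punchIn j c)

laplaceTerm : ∀ {n} → Matrix (suc n) → Fin (suc n) → ℤ
laplaceTerm {n} A j = sgn (toℕ j) * A zero j * det n (minor A j)

sumFin≡sum : ∀ n (f : Fin n → ℤ) → sumFin n f ≡ sum f
sumFin≡sum zero    f = refl
sumFin≡sum (suc n) f = cong (_+_ (f zero)) (sumFin≡sum n (f ∘ suc))

det-expand : ∀ {n} (A : Matrix (suc n)) → det (suc n) A ≡ sum (laplaceTerm A)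
det-expand {n} A = sumFin≡sum (suc n) (laplaceTerm A)

sum-neg : ∀ {n} (f : Fin n → ℤ) → sum (λ i → - f i) ≡ - sum f
sum-neg {zero}  f = refl
sum-neg {suc n} f = trans (cong (_+_ (- f zero)) (sum-neg (f ∘ suc))) (sym (neg-distrib-+ (f zero) _))

sum-zero : ∀ {n} (f : Fin n → ℤ) → (∀ i → f i ≡ + 0) → sum f ≡ + 0
sum-zero {n} f f≗0 = trans (sum-cong-≗ f≗0) (sum-replicate-zero n)

det-cong : ∀ {n} {A B : Matrix n} → (∀ i j → A i j ≡ B i j) → det n A ≡ det n B
det-cong {zero}  A≗B = refl
det-cong {suc n} {A} {B} A≗B = begin
  det (suc n) A        ≡⟨ det-expand A ⟩
  sum (laplaceTerm A)  ≡⟨ sum-cong-≗ termwise ⟩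
  sum (laplaceTerm B)  ≡⟨ det-expand B ⟨
  det (suc n) B        ∎
  where
  open ≡-Reasoning
  termwise : ∀ j → laplaceTerm A j ≡ laplaceTerm B j
  termwise j = cong₂ (λ a d → sgn (toℕ j) * a * d) (A≗B zero j)
                     (det-cong (λ r c → A≗B (suc r) (punchIn j c)))

withRow₀ : ∀ {n} → (Fin (suc n) → ℤ) → Matrix (suc n) → Matrix (suc n)
withRow₀ f A zero    = f
withRow₀ f A (suc r) = A (suc r)

single : ∀ {n} → Fin n → ℤ → Fin n → ℤ
single j₀ c j = if does (j₀ ≟ j) then c else + 0

det-linear₀ : ∀ {n} (A : Matrix (suc n)) (f g : Fin (suc n) → ℤ) → (∀ j → A zero j ≡ f j + g j) →
  det (suc n) A ≡ det (suc n) (withRow₀ f A) + det (suc n) (withRow₀ g A)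
det-linear₀ {n} A f g row₀ = begin
  det (suc n) A                                   ≡⟨ det-expand A ⟩
  sum (laplaceTerm A)                             ≡⟨ sum-cong-≗ split ⟩
  sum (λ j → laplaceTerm F j + laplaceTerm G j)   ≡⟨ ∑-distrib-+ (laplaceTerm F) (laplaceTerm G) ⟩
  sum (laplaceTerm F) + sum (laplaceTerm G)       ≡⟨ cong₂ _+_ (det-expand F) (det-expand G) ⟨
  det (suc n) F + det (suc n) G                   ∎
  where
  open ≡-Reasoning
  F G : Matrix (suc n)
  F = withRow₀ f A
  G = withRow₀ g A
  split : ∀ j → laplaceTerm A j ≡ laplaceTerm F j + laplaceTerm G j
  split j = begin
    s * A zero j * d          ≡⟨ cong (λ a → s * a * d) (row₀ j) ⟩
    s * (f j + g j) * d       ≡⟨ cong (_* d) (*-distribˡ-+ s (f j) (g j)) ⟩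
    (s * f j + s * g j) * d   ≡⟨ *-distribʳ-+ d (s * f j) (s * g j) ⟩
    s * f j * d + s * g j * d ∎
    where
    s = sgn (toℕ j)
    d = det n (minor A j)

det-single₀ : ∀ {n} (A : Matrix (suc n)) (j₀ : Fin (suc n)) (c : ℤ) →
  det (suc n) (withRow₀ (single j₀ c) A) ≡ sgn (toℕ j₀) * c * det n (minor A j₀)
det-single₀ {n} A j₀ c = begin
  det (suc n) E                               ≡⟨ det-expand E ⟩
  sum (laplaceTerm E)                         ≡⟨ sum-remove {i = j₀} (laplaceTerm E) ⟩
  laplaceTerm E j₀ + sum (laplaceTerm E ∘ punchIn j₀)
    ≡⟨ cong₂ _+_ (cong (λ e → sgn (toℕ j₀) * e * det n (minor A j₀)) single-on) (sum-zero _ vanish) ⟩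
  sgn (toℕ j₀) * c * det n (minor A j₀) + + 0 ≡⟨ +-identityʳ _ ⟩
  sgn (toℕ j₀) * c * det n (minor A j₀)       ∎
  where
  open ≡-Reasoning
  E : Matrix (suc n)
  E = withRow₀ (single j₀ c) A
  single-on : single j₀ c j₀ ≡ c
  single-on with j₀ ≟ j₀
  ... | yes _   = refl
  ... | no j≢j = ⊥-elim (j≢j refl)
  single-off : ∀ j → j₀ ≢ j → single j₀ c j ≡ + 0
  single-off j j₀≢j with j₀ ≟ j
  ... | yes j₀≡j = ⊥-elim (j₀≢j j₀≡j)
  ... | no _     = refl
  vanish : ∀ i → laplaceTerm E (punchIn j₀ i) ≡ + 0
  vanish i = begin
    s * single j₀ c (punchIn j₀ i) * d ≡⟨ cong (λ a → s * a * d) (single-off _ (punchInᵢ≢i j₀ i ∘ sym)) ⟩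
    s * + 0 * d                        ≡⟨ cong (_* d) (*-zeroʳ s) ⟩
    + 0 * d                            ≡⟨ *-zeroˡ d ⟩
    + 0                                ∎
    where
    s = sgn (toℕ (punchIn j₀ i))
    d = det n (minor A (punchIn j₀ i))

det-splitRow₀ : ∀ {n} (A : Matrix (suc n)) (j₀ : Fin (suc n)) (c : ℤ) (f : Fin (suc n) → ℤ) →
  (∀ j → A zero j ≡ single j₀ c j + f j) →
  det (suc n) A ≡ sgn (toℕ j₀) * c * det n (minor A j₀) + det (suc n) (withRow₀ f A)
det-splitRow₀ {n} A j₀ c f row₀ =
  trans (det-linear₀ A (single j₀ c) f row₀) (cong (_+ det (suc n) (withRow₀ f A)) (det-single₀ A j₀ c))

sgn-punchOut-swap : ∀ {n} (j j′ : Fin (suc (suc n))) (j≢j′ : j ≢ j′) (j′≢j : j′ ≢ j) →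
  sgn (toℕ j′) * sgn (toℕ (punchOut j′≢j)) ≡ - (sgn (toℕ j) * sgn (toℕ (punchOut j≢j′)))
sgn-punchOut-swap zero    zero     j≢j′ _ = ⊥-elim (j≢j′ refl)
sgn-punchOut-swap zero    (suc j′) _    _ = flip (sgn (toℕ j′))
  where flip : ∀ s → - s * + 1 ≡ - (+ 1 * s)
        flip = solve-∀
sgn-punchOut-swap (suc j) zero     _    _ = flip (sgn (toℕ j))
  where flip : ∀ s → + 1 * s ≡ - (- s * + 1)
        flip = solve-∀
sgn-punchOut-swap {zero}  (suc zero) (suc zero) j≢j′ _ = ⊥-elim (j≢j′ refl)
sgn-punchOut-swap {suc n} (suc j) (suc j′) j≢j′ j′≢j = begin
  - s′ * - t′     ≡⟨ neg-cancel s′ t′ ⟩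
  s′ * t′         ≡⟨ sgn-punchOut-swap j j′ (j≢j′ ∘ cong suc) (j′≢j ∘ cong suc) ⟩
  - (s * t)       ≡⟨ cong -_ (neg-cancel s t) ⟨
  - (- s * - t)   ∎
  where
  open ≡-Reasoning
  s  = sgn (toℕ j)
  s′ = sgn (toℕ j′)
  t  = sgn (toℕ (punchOut (j≢j′ ∘ cong suc)))
  t′ = sgn (toℕ (punchOut (j′≢j ∘ cong suc)))
  neg-cancel : ∀ a b → - a * - b ≡ a * b
  neg-cancel = solve-∀

punchIn-punchOut-comm : ∀ {n} (j j′ : Fin (suc (suc n))) (j≢j′ : j ≢ j′) (j′≢j : j′ ≢ j) (c : Fin n) →
  punchIn j′ (punchIn (punchOut j′≢j) c) ≡ punchIn j (punchIn (punchOut j≢j′) c)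
punchIn-punchOut-comm zero    zero     j≢j′ _ c = ⊥-elim (j≢j′ refl)
punchIn-punchOut-comm zero    (suc j′) _    _ c = refl
punchIn-punchOut-comm (suc j) zero     _    _ c = refl
punchIn-punchOut-comm {suc n} (suc j) (suc j′) _ _ zero = refl
punchIn-punchOut-comm {suc n} (suc j) (suc j′) j≢j′ j′≢j (suc c) =
  cong suc (punchIn-punchOut-comm j j′ (j≢j′ ∘ cong suc) (j′≢j ∘ cong suc) c)

module _ {n : ℕ} (A : Matrix (suc (suc n))) where

  -- The term of the expansion along rows 0 and 1 at once in which row 0 uses column j and row 1
  -- column j′.
  pairTerm : Fin (suc (suc n)) → Fin (suc (suc n)) → ℤ
  pairTerm j j′ with j ≟ j′
  ... | yes _    = + 0
  ... | no j≢j′ = sgn (toℕ j) * A zero j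
                   * (sgn (toℕ (punchOut j≢j′)) * A (suc zero) j′ * det n (minor (minor A j) (punchOut j≢j′)))

  pairTerm-diag : ∀ j → pairTerm j j ≡ + 0
  pairTerm-diag j with j ≟ j
  ... | yes _    = refl
  ... | no j≢j = ⊥-elim (j≢j refl)

  pairTerm-punchIn : ∀ j l → pairTerm j (punchIn j l) ≡ sgn (toℕ j) * A zero j * laplaceTerm (minor A j) l
  pairTerm-punchIn j l with j ≟ punchIn j l
  ... | yes j≡ = ⊥-elim (punchInᵢ≢i j l (sym j≡))
  ... | no j≢  =
    cong (λ l′ → sgn (toℕ j) * A zero j * (sgn (toℕ l′) * A (suc zero) (punchIn j l) * det n (minor (minor A j) l′)))
         (trans (punchOut-cong j refl) (punchOut-punchIn j))

  det-pairExpand : det (suc (suc n)) A ≡ sum (λ j → sum (pairTerm j))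
  det-pairExpand = trans (det-expand A) (sum-cong-≗ expandRow₁)
    where
    open ≡-Reasoning
    expandRow₁ : ∀ j → laplaceTerm A j ≡ sum (pairTerm j)
    expandRow₁ j = begin
      a * det (suc n) (minor A j)                      ≡⟨ cong (a *_) (det-expand (minor A j)) ⟩
      a * sum (laplaceTerm (minor A j))                ≡⟨ *-distribˡ-sum a (laplaceTerm (minor A j)) ⟩
      sum (λ l → a * laplaceTerm (minor A j) l)        ≡⟨ sum-cong-≗ (λ l → sym (pairTerm-punchIn j l)) ⟩
      sum (pairTerm j ∘ punchIn j)                     ≡⟨ +-identityˡ _ ⟨
      + 0 + sum (pairTerm j ∘ punchIn j)               ≡⟨ cong (_+ sum (pairTerm j ∘ punchIn j)) (pairTerm-diag j) ⟨
      pairTerm j j + sum (pairTerm j ∘ punchIn j)      ≡⟨ sum-remove {i = j} (pairTerm j) ⟨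
      sum (pairTerm j)                                 ∎
      where a = sgn (toℕ j) * A zero j

swapRows₀₁ : ∀ {n} → Matrix (suc (suc n)) → Matrix (suc (suc n))
swapRows₀₁ A zero          = A (suc zero)
swapRows₀₁ A (suc zero)    = A zero
swapRows₀₁ A (suc (suc r)) = A (suc (suc r))

swapRows₁₂ : ∀ {n} → Matrix (suc (suc (suc n))) → Matrix (suc (suc (suc n)))
swapRows₁₂ A zero                = A zero
swapRows₁₂ A (suc zero)          = A (suc (suc zero))
swapRows₁₂ A (suc (suc zero))    = A (suc zero)
swapRows₁₂ A (suc (suc (suc r))) = A (suc (suc (suc r)))

det-swapRows₀₁ : ∀ {n} (A : Matrix (suc (suc n))) → det (suc (suc n)) (swapRows₀₁ A) ≡ - det (suc (suc n)) A
det-swapRows₀₁ {n} A = begin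
  det (suc (suc n)) B                          ≡⟨ det-pairExpand B ⟩
  sum (λ a → sum (pairTerm B a))               ≡⟨ sum-cong-≗ (λ a → sum-cong-≗ (pairTerm-swap a)) ⟩
  sum (λ a → sum (λ b → - pairTerm A b a))     ≡⟨ sum-cong-≗ (λ a → sum-neg (λ b → pairTerm A b a)) ⟩
  sum (λ a → - sum (λ b → pairTerm A b a))     ≡⟨ sum-neg (λ a → sum (λ b → pairTerm A b a)) ⟩
  - sum (λ a → sum (λ b → pairTerm A b a))     ≡⟨ cong -_ (∑-comm (λ a b → pairTerm A b a)) ⟩
  - sum (λ b → sum (pairTerm A b))             ≡⟨ cong -_ (det-pairExpand A) ⟨
  - det (suc (suc n)) A                        ∎
  where
  open ≡-Reasoning
  B : Matrix (suc (suc n))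
  B = swapRows₀₁ A
  swap-signs : ∀ s₁ s₂ s₃ s₄ u v d → s₁ * s₂ ≡ - (s₃ * s₄) →
               s₁ * u * (s₂ * v * d) ≡ - (s₃ * v * (s₄ * u * d))
  swap-signs s₁ s₂ s₃ s₄ u v d s₁s₂≡ = begin
    s₁ * u * (s₂ * v * d)         ≡⟨ regroup s₁ s₂ u v d ⟩
    s₁ * s₂ * (u * v * d)         ≡⟨ cong (_* (u * v * d)) s₁s₂≡ ⟩
    - (s₃ * s₄) * (u * v * d)     ≡⟨ regroup⁻ s₃ s₄ u v d ⟩
    - (s₃ * v * (s₄ * u * d))     ∎
    where
    regroup : ∀ s₁ s₂ u v d → s₁ * u * (s₂ * v * d) ≡ s₁ * s₂ * (u * v * d)
    regroup = solve-∀
    regroup⁻ : ∀ s₃ s₄ u v d → - (s₃ * s₄) * (u * v * d) ≡ - (s₃ * v * (s₄ * u * d))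
    regroup⁻ = solve-∀
  pairTerm-swap : ∀ a b → pairTerm B a b ≡ - pairTerm A b a
  pairTerm-swap a b with a ≟ b | b ≟ a
  ... | yes _   | yes _   = refl
  ... | yes a≡b | no b≢a = ⊥-elim (b≢a (sym a≡b))
  ... | no a≢b  | yes b≡a = ⊥-elim (a≢b (sym b≡a))
  ... | no a≢b  | no b≢a  = begin
    sa * A (suc zero) a * (sa′ * A zero b * det n (minor (minor B a) (punchOut a≢b)))
      ≡⟨ cong (λ d → sa * A (suc zero) a * (sa′ * A zero b * d)) (det-cong sameMinor) ⟩
    sa * A (suc zero) a * (sa′ * A zero b * D)
      ≡⟨ swap-signs sa sa′ sb sb′ (A (suc zero) a) (A zero b) D (sgn-punchOut-swap b a b≢a a≢b) ⟩
    - (sb * A zero b * (sb′ * A (suc zero) a * D)) ∎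
    where
    sa  = sgn (toℕ a)
    sa′ = sgn (toℕ (punchOut a≢b))
    sb  = sgn (toℕ b)
    sb′ = sgn (toℕ (punchOut b≢a))
    D   = det n (minor (minor A b) (punchOut b≢a))
    sameMinor : ∀ r c → minor (minor B a) (punchOut a≢b) r c ≡ minor (minor A b) (punchOut b≢a) r c
    sameMinor r c = cong (A (suc (suc r))) (punchIn-punchOut-comm b a b≢a a≢b c)

det-swapRows₁₂ : ∀ {n} (A : Matrix (suc (suc (suc n)))) →
  det (suc (suc (suc n))) (swapRows₁₂ A) ≡ - det (suc (suc (suc n))) A
det-swapRows₁₂ {n} A = begin
  det (suc (suc (suc n))) (swapRows₁₂ A)                    ≡⟨ det-expand (swapRows₁₂ A) ⟩
  sum (laplaceTerm (swapRows₁₂ A))                          ≡⟨ sum-cong-≗ negateTerm ⟩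
  sum (λ j → - laplaceTerm A j)                             ≡⟨ sum-neg (laplaceTerm A) ⟩
  - sum (laplaceTerm A)                                     ≡⟨ cong -_ (det-expand A) ⟨
  - det (suc (suc (suc n))) A                               ∎
  where
  open ≡-Reasoning
  minor-swap : ∀ j r c → minor (swapRows₁₂ A) j r c ≡ swapRows₀₁ (minor A j) r c
  minor-swap j zero          c = refl
  minor-swap j (suc zero)    c = refl
  minor-swap j (suc (suc r)) c = refl
  negateTerm : ∀ j → laplaceTerm (swapRows₁₂ A) j ≡ - laplaceTerm A j
  negateTerm j = begin
    s * det (suc (suc n)) (minor (swapRows₁₂ A) j)  ≡⟨ cong (s *_) (det-cong (minor-swap j)) ⟩
    s * det (suc (suc n)) (swapRows₀₁ (minor A j))  ≡⟨ cong (s *_) (det-swapRows₀₁ (minor A j)) ⟩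
    s * - det (suc (suc n)) (minor A j)              ≡⟨ neg-distribʳ-* s _ ⟨
    - (s * det (suc (suc n)) (minor A j))            ∎
    where
    s = sgn (toℕ j) * A zero j

i≡-i⇒i≡0 : ∀ (i : ℤ) → i ≡ - i → i ≡ + 0
i≡-i⇒i≡0 (+ zero)    _  = refl
i≡-i⇒i≡0 (+ suc m)   ()
i≡-i⇒i≡0 -[1+ m ]    ()

det-equalRows₀₁ : ∀ {n} (A : Matrix (suc (suc n))) → (∀ j → A zero j ≡ A (suc zero) j) →
  det (suc (suc n)) A ≡ + 0
det-equalRows₀₁ {n} A row₀≡row₁ = i≡-i⇒i≡0 _ (begin
  det (suc (suc n)) A               ≡⟨ det-cong same ⟨
  det (suc (suc n)) (swapRows₀₁ A)  ≡⟨ det-swapRows₀₁ A ⟩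
  - det (suc (suc n)) A             ∎)
  where
  open ≡-Reasoning
  same : ∀ r c → swapRows₀₁ A r c ≡ A r c
  same zero          c = sym (row₀≡row₁ c)
  same (suc zero)    c = row₀≡row₁ c
  same (suc (suc r)) c = refl

det-equalRows₁₂ : ∀ {n} (A : Matrix (suc (suc (suc n)))) → (∀ j → A (suc zero) j ≡ A (suc (suc zero)) j) →
  det (suc (suc (suc n))) A ≡ + 0
det-equalRows₁₂ {n} A row₁≡row₂ = trans (det-expand A) (sum-zero (laplaceTerm A) vanish)
  where
  vanish : ∀ j → laplaceTerm A j ≡ + 0
  vanish j = trans (cong (sgn (toℕ j) * A zero j *_) (det-equalRows₀₁ (minor A j) (λ c → row₁≡row₂ _)))
                   (*-zeroʳ (sgn (toℕ j) * A zero j))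

det-equalRows₀₂ : ∀ {n} (A : Matrix (suc (suc (suc n)))) → (∀ j → A zero j ≡ A (suc (suc zero)) j) →
  det (suc (suc (suc n))) A ≡ + 0
det-equalRows₀₂ {n} A row₀≡row₂ = begin
  det (suc (suc (suc n))) A                    ≡⟨ neg-involutive _ ⟨
  - - det (suc (suc (suc n))) A                ≡⟨ cong -_ (det-swapRows₁₂ A) ⟨
  - det (suc (suc (suc n))) (swapRows₁₂ A)     ≡⟨ cong -_ (det-equalRows₀₁ (swapRows₁₂ A) row₀≡row₂) ⟩
  - + 0                                        ≡⟨⟩
  + 0                                          ∎
  where open ≡-Reasoning

det-2×2 : (A : Matrix 2) →
  det 2 A ≡ A zero zero * A (suc zero) (suc zero) - A zero (suc zero) * A (suc zero) zero
det-2×2 A = expand (A zero zero) (A zero (suc zero)) (A (suc zero) zero) (A (suc zero) (suc zero))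
  where
  expand : ∀ a b c d → + 1 * a * (+ 1 * d * + 1 + + 0) + (- + 1 * b * (+ 1 * c * + 1 + + 0) + + 0) ≡ a * d - b * c
  expand = solve-∀

-- The characteristic matrix of a path matrix with two vertex types

pathCount : Bool → Bool → ℕ
pathCount true true = 2
pathCount _    _    = 1

Bool-pigeonhole : ∀ (a b c : Bool) → a ≡ b ⊎ a ≡ c ⊎ b ≡ c
Bool-pigeonhole true  true  _     = inj₁ refl
Bool-pigeonhole false false _     = inj₁ refl
Bool-pigeonhole true  false true  = inj₂ (inj₁ refl)
Bool-pigeonhole true  false false = inj₂ (inj₂ refl)
Bool-pigeonhole false true  true  = inj₂ (inj₂ refl)
Bool-pigeonhole false true  false = inj₂ (inj₁ refl)

-- typeMatrix v = diag (δ vᵢ) + (β vᵢ vⱼ), and the second summand has just the two distinct rows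
-- βRow true and βRow false (true = on the cycle); typeMatrix₁ and typeMatrix₂ have their first
-- one or two rows replaced by such β-rows.
module TypeMatrix (x : ℤ) where

  β : Bool → Bool → ℤ
  β σ τ = - + pathCount σ τ

  δ : Bool → ℤ
  δ σ = x + + pathCount σ σ

  x≡δ+β : ∀ σ → x ≡ δ σ + β σ σ
  x≡δ+β σ = shift x (+ pathCount σ σ)
    where
    shift : ∀ x c → x ≡ x + c + - c
    shift = solve-∀

  typeMatrix : ∀ {m} → Subset m → Matrix m
  typeMatrix v i j = if does (i ≟ j) then x else β (lookup v i) (lookup v j)

  charMat≗typeMatrix : ∀ {m} (M : Fin m → Fin m → ℕ) (v : Subset m) → (∀ i → M i i ≡ 0) →
    (∀ i j → i ≢ j → M i j ≡ pathCount (lookup v i) (lookup v j)) →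
    ∀ i j → charMat m x M i j ≡ typeMatrix v i j
  charMat≗typeMatrix M v diagonal offDiagonal i j with i ≟ j
  ... | yes refl = trans (cong (λ d → x - + d) (diagonal i)) (+-identityʳ x)
  ... | no i≢j   = cong (λ e → - + e) (offDiagonal i j i≢j)

  βRow : ∀ {m} → Bool → Subset m → Fin m → ℤ
  βRow σ v j = β σ (lookup v j)

  typeMatrix₁ : ∀ {m} → Subset (suc m) → Matrix (suc m)
  typeMatrix₁ v = withRow₀ (βRow (head v) v) (typeMatrix v)

  typeMatrix₂ : ∀ {m} → Bool → Bool → Subset (suc (suc m)) → Matrix (suc (suc m))
  typeMatrix₂ α γ v zero          = βRow α v
  typeMatrix₂ α γ v (suc zero)    = βRow γ v
  typeMatrix₂ α γ v (suc (suc r)) = typeMatrix v (suc (suc r))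

  det-typeMatrix-∷ : ∀ {m} σ (w : Subset m) →
    det (suc m) (typeMatrix (σ ∷ w)) ≡ δ σ * det m (typeMatrix w) + det (suc m) (typeMatrix₁ (σ ∷ w))
  det-typeMatrix-∷ {m} σ w =
    trans (det-splitRow₀ (typeMatrix (σ ∷ w)) zero (δ σ) (βRow σ (σ ∷ w)) row₀)
          (cong (λ a → a * det m (typeMatrix w) + det (suc m) (typeMatrix₁ (σ ∷ w))) (*-identityˡ (δ σ)))
    where
    row₀ : ∀ j → typeMatrix (σ ∷ w) zero j ≡ single zero (δ σ) j + βRow σ (σ ∷ w) j
    row₀ zero    = x≡δ+β σ
    row₀ (suc j) = sym (+-identityˡ _)

  det-typeMatrix₁-∷ : ∀ {m} σ τ (w : Subset m) →
    det (suc (suc m)) (typeMatrix₁ (σ ∷ τ ∷ w))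
      ≡ δ τ * det (suc m) (typeMatrix₁ (σ ∷ w)) - det (suc (suc m)) (typeMatrix₂ τ σ (σ ∷ τ ∷ w))
  det-typeMatrix₁-∷ {m} σ τ w = begin
    det (suc (suc m)) H        ≡⟨ neg-involutive _ ⟨
    - - det (suc (suc m)) H    ≡⟨ cong -_ (det-swapRows₀₁ H) ⟨
    - det (suc (suc m)) S      ≡⟨ cong -_ (det-splitRow₀ S (suc zero) (δ τ) (βRow τ v) row₀) ⟩
    - (- + 1 * δ τ * det (suc m) (minor S (suc zero)) + det (suc (suc m)) (withRow₀ (βRow τ v) S))
      ≡⟨ cong₂ (λ D₁ D₂ → - (- + 1 * δ τ * D₁ + D₂)) (det-cong minor≗) (det-cong split≗) ⟩
    - (- + 1 * δ τ * D₁ + D₂)  ≡⟨ rearrange (δ τ) D₁ D₂ ⟩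
    δ τ * D₁ - D₂              ∎
    where
    open ≡-Reasoning
    v : Subset (suc (suc m))
    v = σ ∷ τ ∷ w
    H S : Matrix (suc (suc m))
    H = typeMatrix₁ v
    S = swapRows₀₁ H
    D₁ = det (suc m) (typeMatrix₁ (σ ∷ w))
    D₂ = det (suc (suc m)) (typeMatrix₂ τ σ v)
    rearrange : ∀ d D₁ D₂ → - (- + 1 * d * D₁ + D₂) ≡ d * D₁ - D₂
    rearrange = solve-∀
    row₀ : ∀ j → S zero j ≡ single (suc zero) (δ τ) j + βRow τ v j
    row₀ zero          = sym (+-identityˡ _)
    row₀ (suc zero)    = x≡δ+β τ
    row₀ (suc (suc j)) = sym (+-identityˡ _)
    minor≗ : ∀ r c → minor S (suc zero) r c ≡ typeMatrix₁ (σ ∷ w) r c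
    minor≗ zero    zero    = refl
    minor≗ zero    (suc c) = refl
    minor≗ (suc r) zero    = refl
    minor≗ (suc r) (suc c) = refl
    split≗ : ∀ r c → withRow₀ (βRow τ v) S r c ≡ typeMatrix₂ τ σ v r c
    split≗ zero          c = refl
    split≗ (suc zero)    c = refl
    split≗ (suc (suc r)) c = refl

  det-typeMatrix₂-∷ : ∀ {m} α γ a b d (w : Subset m) →
    det (suc (suc (suc m))) (typeMatrix₂ α γ (a ∷ b ∷ d ∷ w))
      ≡ δ d * det (suc (suc m)) (typeMatrix₂ α γ (a ∷ b ∷ w))
  det-typeMatrix₂-∷ {m} α γ a b d w = begin
    det (suc (suc (suc m))) H                  ≡⟨ neg-involutive _ ⟨
    - - det (suc (suc (suc m))) H              ≡⟨ cong -_ (det-swapRows₁₂ H) ⟨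
    - det (suc (suc (suc m))) (swapRows₁₂ H)   ≡⟨ det-swapRows₀₁ (swapRows₁₂ H) ⟨
    det (suc (suc (suc m))) R                  ≡⟨ det-splitRow₀ R (suc (suc zero)) (δ d) (βRow d v) row₀ ⟩
    + 1 * δ d * det (suc (suc m)) (minor R (suc (suc zero))) + det (suc (suc (suc m))) (withRow₀ (βRow d v) R)
      ≡⟨ cong₂ (λ D E → + 1 * δ d * D + E) (det-cong minor≗) threeβRows ⟩
    + 1 * δ d * D + + 0                        ≡⟨ simplify (δ d) D ⟩
    δ d * D                                    ∎
    where
    open ≡-Reasoning
    v : Subset (suc (suc (suc m)))
    v = a ∷ b ∷ d ∷ w
    H R : Matrix (suc (suc (suc m)))
    H = typeMatrix₂ α γ v
    R = swapRows₀₁ (swapRows₁₂ H)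
    D = det (suc (suc m)) (typeMatrix₂ α γ (a ∷ b ∷ w))
    simplify : ∀ d D → + 1 * d * D + + 0 ≡ d * D
    simplify = solve-∀
    row₀ : ∀ j → R zero j ≡ single (suc (suc zero)) (δ d) j + βRow d v j
    row₀ zero                = sym (+-identityˡ _)
    row₀ (suc zero)          = sym (+-identityˡ _)
    row₀ (suc (suc zero))    = x≡δ+β d
    row₀ (suc (suc (suc j))) = sym (+-identityˡ _)
    minor≗ : ∀ r c → minor R (suc (suc zero)) r c ≡ typeMatrix₂ α γ (a ∷ b ∷ w) r c
    minor≗ zero          zero          = refl
    minor≗ zero          (suc zero)    = refl
    minor≗ zero          (suc (suc c)) = refl
    minor≗ (suc zero)    zero          = refl
    minor≗ (suc zero)    (suc zero)    = refl
    minor≗ (suc zero)    (suc (suc c)) = refl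
    minor≗ (suc (suc r)) zero          = refl
    minor≗ (suc (suc r)) (suc zero)    = refl
    minor≗ (suc (suc r)) (suc (suc c)) = refl
    sameRow : ∀ {σ τ} → σ ≡ τ → ∀ j → βRow σ v j ≡ βRow τ v j
    sameRow σ≡τ j = cong (λ σ → β σ (lookup v j)) σ≡τ
    threeβRows : det (suc (suc (suc m))) (withRow₀ (βRow d v) R) ≡ + 0
    threeβRows with Bool-pigeonhole d α γ
    ... | inj₁ d≡α        = det-equalRows₀₁ (withRow₀ (βRow d v) R) (sameRow d≡α)
    ... | inj₂ (inj₁ d≡γ) = det-equalRows₀₂ (withRow₀ (βRow d v) R) (sameRow d≡γ)
    ... | inj₂ (inj₂ α≡γ) = det-equalRows₁₂ (withRow₀ (βRow d v) R) (sameRow α≡γ)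

  p q : ℤ
  p = δ true
  q = δ false

  -- k · b ^ (k ∸ 1), the derivative of b ^ k, written via the product rule.
  powDeriv : ℤ → ℕ → ℤ
  powDeriv b zero    = + 0
  powDeriv b (suc k) = b ^ k + b * powDeriv b k

  cross : Bool → Bool → Bool → Bool → ℤ
  cross α γ a b = β α a * β γ b - β α b * β γ a

  χ₁ : Bool → ℕ → ℕ → ℤ
  χ₁ true  k t = - + 2 * (p ^ k * q ^ t) + p ^ k * powDeriv q t
  χ₁ false k t = - (p ^ k * q ^ t) + powDeriv p k * q ^ t

  χ : ℕ → ℕ → ℤ
  χ k t = p ^ k * q ^ t - + 2 * powDeriv p k * q ^ t - p ^ k * powDeriv q t + powDeriv p k * powDeriv q t

  det-typeMatrix₂ : ∀ {m} α γ a b (w : Subset m) →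
    det (suc (suc m)) (typeMatrix₂ α γ (a ∷ b ∷ w)) ≡ cross α γ a b * (p ^ ∣ w ∣ * q ^ ∣ ∁ w ∣)
  det-typeMatrix₂ α γ a b []      = trans (det-2×2 (typeMatrix₂ α γ (a ∷ b ∷ []))) (sym (*-identityʳ _))
  det-typeMatrix₂ α γ a b (d ∷ w) =
    trans (det-typeMatrix₂-∷ α γ a b d w)
          (trans (cong (δ d *_) (det-typeMatrix₂ α γ a b w)) (step d))
    where
    step : ∀ d → δ d * (cross α γ a b * (p ^ ∣ w ∣ * q ^ ∣ ∁ w ∣))
                 ≡ cross α γ a b * (p ^ ∣ d ∷ w ∣ * q ^ ∣ ∁ (d ∷ w) ∣)
    step true  = absorb p (cross α γ a b) (p ^ ∣ w ∣) (q ^ ∣ ∁ w ∣)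
      where absorb : ∀ p C P Q → p * (C * (P * Q)) ≡ C * (p * P * Q)
            absorb = solve-∀
    step false = absorb q (cross α γ a b) (p ^ ∣ w ∣) (q ^ ∣ ∁ w ∣)
      where absorb : ∀ q C P Q → q * (C * (P * Q)) ≡ C * (P * (q * Q))
            absorb = solve-∀

  χ₁-∷ : ∀ {m} σ τ (w : Subset m) →
    δ τ * χ₁ σ (∣ w ∣) (∣ ∁ w ∣) - cross τ σ σ τ * (p ^ ∣ w ∣ * q ^ ∣ ∁ w ∣) ≡ χ₁ σ (∣ τ ∷ w ∣) (∣ ∁ (τ ∷ w) ∣)
  χ₁-∷ true  true  w = identity p (p ^ ∣ w ∣) (q ^ ∣ ∁ w ∣) (powDeriv q ∣ ∁ w ∣)
    where identity : ∀ p P Q D → p * (- + 2 * (P * Q) + P * D) - + 0 * (P * Q) ≡ - + 2 * (p * P * Q) + p * P * D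
          identity = solve-∀
  χ₁-∷ true  false w = identity q (p ^ ∣ w ∣) (q ^ ∣ ∁ w ∣) (powDeriv q ∣ ∁ w ∣)
    where identity : ∀ q P Q D → q * (- + 2 * (P * Q) + P * D) - - + 1 * (P * Q) ≡ - + 2 * (P * (q * Q)) + P * (Q + q * D)
          identity = solve-∀
  χ₁-∷ false true  w = identity p (p ^ ∣ w ∣) (q ^ ∣ ∁ w ∣) (powDeriv p ∣ w ∣)
    where identity : ∀ p P Q D → p * (- (P * Q) + D * Q) - - + 1 * (P * Q) ≡ - (p * P * Q) + (P + p * D) * Q
          identity = solve-∀
  χ₁-∷ false false w = identity q (p ^ ∣ w ∣) (q ^ ∣ ∁ w ∣) (powDeriv p ∣ w ∣)
    where identity : ∀ q P Q D → q * (- (P * Q) + D * Q) - + 0 * (P * Q) ≡ - (P * (q * Q)) + D * (q * Q)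
          identity = solve-∀

  det-typeMatrix₁ : ∀ {m} σ (w : Subset m) → det (suc m) (typeMatrix₁ (σ ∷ w)) ≡ χ₁ σ (∣ w ∣) (∣ ∁ w ∣)
  det-typeMatrix₁ true  []      = refl
  det-typeMatrix₁ false []      = refl
  det-typeMatrix₁ {suc m} σ (τ ∷ w) = begin
    det (suc (suc m)) (typeMatrix₁ (σ ∷ τ ∷ w))        ≡⟨ det-typeMatrix₁-∷ σ τ w ⟩
    δ τ * det (suc m) (typeMatrix₁ (σ ∷ w)) - det (suc (suc m)) (typeMatrix₂ τ σ (σ ∷ τ ∷ w))
      ≡⟨ cong₂ (λ D₁ D₂ → δ τ * D₁ - D₂) (det-typeMatrix₁ σ w) (det-typeMatrix₂ τ σ σ τ w) ⟩
    δ τ * χ₁ σ (∣ w ∣) (∣ ∁ w ∣) - cross τ σ σ τ * (p ^ ∣ w ∣ * q ^ ∣ ∁ w ∣) ≡⟨ χ₁-∷ σ τ w ⟩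
    χ₁ σ (∣ τ ∷ w ∣) (∣ ∁ (τ ∷ w) ∣)                         ∎
    where open ≡-Reasoning

  χ-∷ : ∀ {m} σ (w : Subset m) →
    δ σ * χ (∣ w ∣) (∣ ∁ w ∣) + χ₁ σ (∣ w ∣) (∣ ∁ w ∣) ≡ χ (∣ σ ∷ w ∣) (∣ ∁ (σ ∷ w) ∣)
  χ-∷ true  w = identity p (p ^ ∣ w ∣) (q ^ ∣ ∁ w ∣) (powDeriv p ∣ w ∣) (powDeriv q ∣ ∁ w ∣)
    where identity : ∀ p P Q Dp Dq → p * (P * Q - + 2 * Dp * Q - P * Dq + Dp * Dq) + (- + 2 * (P * Q) + P * Dq)
                                   ≡ p * P * Q - + 2 * (P + p * Dp) * Q - p * P * Dq + (P + p * Dp) * Dq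
          identity = solve-∀
  χ-∷ false w = identity q (p ^ ∣ w ∣) (q ^ ∣ ∁ w ∣) (powDeriv p ∣ w ∣) (powDeriv q ∣ ∁ w ∣)
    where identity : ∀ q P Q Dp Dq → q * (P * Q - + 2 * Dp * Q - P * Dq + Dp * Dq) + (- (P * Q) + Dp * Q)
                                   ≡ P * (q * Q) - + 2 * Dp * (q * Q) - P * (Q + q * Dq) + Dp * (Q + q * Dq)
          identity = solve-∀

  det-typeMatrix : ∀ {m} (v : Subset m) → det m (typeMatrix v) ≡ χ (∣ v ∣) (∣ ∁ v ∣)
  det-typeMatrix []      = refl
  det-typeMatrix {suc m} (σ ∷ w) = begin
    det (suc m) (typeMatrix (σ ∷ w))                               ≡⟨ det-typeMatrix-∷ σ w ⟩
    δ σ * det m (typeMatrix w) + det (suc m) (typeMatrix₁ (σ ∷ w))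
      ≡⟨ cong₂ (λ D D₁ → δ σ * D + D₁) (det-typeMatrix w) (det-typeMatrix₁ σ w) ⟩
    δ σ * χ (∣ w ∣) (∣ ∁ w ∣) + χ₁ σ (∣ w ∣) (∣ ∁ w ∣)                    ≡⟨ χ-∷ σ w ⟩
    χ (∣ σ ∷ w ∣) (∣ ∁ (σ ∷ w) ∣)                                      ∎
    where open ≡-Reasoning

  powDeriv-suc : ∀ b k → powDeriv b (suc k) ≡ + suc k * b ^ k
  powDeriv-suc b zero    = base b
    where base : ∀ b → + 1 + b * + 0 ≡ + 1 * + 1
          base = solve-∀
  powDeriv-suc b (suc k) = trans (cong (λ D → b ^ suc k + b * D) (powDeriv-suc b k)) (step b (b ^ k) (+ k))
    where step : ∀ b B k → b * B + b * ((+ 1 + k) * B) ≡ (+ 1 + (+ 1 + k)) * (b * B)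
          step = solve-∀

  quadratic : ℕ → ℕ → ℤ
  quadratic n k = x * x - (+ n + + k - + 3) * x - (+ k * + k - + n * + k + + 2 * + n - + 2)

  χ-factorisation : ∀ n k → 0 < k → k < n → χ k (n ∸ k) ≡ p ^ (k ∸ 1) * q ^ (n ∸ k ∸ 1) * quadratic n k
  χ-factorisation n (suc a) _ k<n with n ∸ suc a in n∸k≡ | m<n⇒0<n∸m k<n
  ... | suc b | _ = begin
    χ (suc a) (suc b)
      ≡⟨ cong₂ (λ Dp Dq → p ^ suc a * q ^ suc b - + 2 * Dp * q ^ suc b - p ^ suc a * Dq + Dp * Dq)
               (powDeriv-suc p a) (powDeriv-suc q b) ⟩
    p ^ suc a * q ^ suc b - + 2 * (+ suc a * p ^ a) * q ^ suc b
      - p ^ suc a * (+ suc b * q ^ b) + (+ suc a * p ^ a) * (+ suc b * q ^ b)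
      ≡⟨ factorise x (p ^ a) (q ^ b) (+ a) (+ b) ⟩
    p ^ a * q ^ b * quadratic (suc a ℕ.+ suc b) (suc a)       ≡⟨ cong (λ n → p ^ a * q ^ b * quadratic n (suc a)) n≡ ⟩
    p ^ a * q ^ b * quadratic n (suc a)                     ∎
    where
    open ≡-Reasoning
    factorise : ∀ x P Q A B →
      (x + + 2) * P * ((x + + 1) * Q) - + 2 * ((+ 1 + A) * P) * ((x + + 1) * Q)
        - (x + + 2) * P * ((+ 1 + B) * Q) + (+ 1 + A) * P * ((+ 1 + B) * Q)
      ≡ P * Q * (x * x - ((+ 1 + A) + (+ 1 + B) + (+ 1 + A) - + 3) * x
                 - ((+ 1 + A) * (+ 1 + A) - ((+ 1 + A) + (+ 1 + B)) * (+ 1 + A) + + 2 * ((+ 1 + A) + (+ 1 + B)) - + 2))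
    factorise = solve-∀
    n≡ : suc a ℕ.+ suc b ≡ n
    n≡ = trans (cong (suc a ℕ.+_) (sym n∸k≡)) (m+[n∸m]≡n (<⇒≤ k<n))

module _ {A : Set} where

  reverse-∷-∷ʳ : ∀ (u : A) xs v → reverse (u ∷ xs ++ [ v ]) ≡ v ∷ reverse xs ++ [ u ]
  reverse-∷-∷ʳ u xs v = trans (unfold-reverse u (xs ++ [ v ])) (cong (_++ [ u ]) (reverse-++ xs [ v ]))

  rotation : ∀ (c u : A) P Q → c ∷ P ++ u ∷ Q ↭ u ∷ Q ++ c ∷ P
  rotation c u P Q = ++-comm (c ∷ P) (u ∷ Q)

  Unique-↭ : ∀ {xs ys : List A} → xs ↭ ys → Unique xs → Unique ys
  Unique-↭ xs↭ys = PermutationS.Unique-resp-↭ (setoid A) (↭⇒↭ₛ xs↭ys)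

  Unique-reverse : ∀ {xs : List A} → Unique xs → Unique (reverse xs)
  Unique-reverse {xs} = Unique-↭ (↭-sym (↭-reverse xs))

  Unique-++⁻ : ∀ xs {ys : List A} → Unique (xs ++ ys) → Unique xs × Unique ys
  Unique-++⁻ []       u        = [] , u
  Unique-++⁻ (x ∷ xs) (x∉ ∷ u) with Unique-++⁻ xs u
  ... | uxs , uys = ++⁻ˡ xs x∉ ∷ uxs , uys

  Unique-++⇒disjoint : ∀ xs {ys : List A} → Unique (xs ++ ys) → ∀ {y} → y ∈ xs → y ∉ ys
  Unique-++⇒disjoint (x ∷ xs) (x∉ ∷ _) (here refl) y∈ys = All.lookup x∉ (∈-++⁺ʳ xs y∈ys) refl
  Unique-++⇒disjoint (x ∷ xs) (_ ∷ u)  (there y∈xs) = Unique-++⇒disjoint xs u y∈xs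

  module _ {ℓ} {R : Rel A ℓ} where

    Linked-split : ∀ xs {y ys} → Linked R (xs ++ y ∷ ys) → Linked R (xs ++ [ y ]) × Linked R (y ∷ ys)
    Linked-split []           l       = [-] , l
    Linked-split (x ∷ [])     (r ∷ l) = r ∷ [-] , l
    Linked-split (x ∷ x′ ∷ xs) (r ∷ l) with Linked-split (x′ ∷ xs) l
    ... | l₁ , l₂ = r ∷ l₁ , l₂

    Linked-join : ∀ xs {y ys} → Linked R (xs ++ [ y ]) → Linked R (y ∷ ys) → Linked R (xs ++ y ∷ ys)
    Linked-join []            _        l₂ = l₂
    Linked-join (x ∷ [])      (r ∷ _)  l₂ = r ∷ l₂
    Linked-join (x ∷ x′ ∷ xs) (r ∷ l₁) l₂ = r ∷ Linked-join (x′ ∷ xs) l₁ l₂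

    Linked-reverse : Symmetric R → ∀ {xs} → Linked R xs → Linked R (reverse xs)
    Linked-reverse R-sym []      = []
    Linked-reverse R-sym [-]     = [-]
    Linked-reverse R-sym {x ∷ y ∷ ys} (r ∷ l) =
      subst (Linked R) (sym reverse≡) (Linked-join (reverse ys) l′ (R-sym r ∷ [-]))
      where
      reverse≡ : reverse (x ∷ y ∷ ys) ≡ reverse ys ++ y ∷ [ x ]
      reverse≡ = trans (unfold-reverse x (y ∷ ys))
                       (trans (cong (_++ [ x ]) (unfold-reverse y ys)) (++-assoc (reverse ys) [ y ] [ x ]))
      l′ : Linked R (reverse ys ++ [ y ])
      l′ = subst (Linked R) (unfold-reverse y ys) (Linked-reverse R-sym l)

  Consec⇒∈ : ∀ {xs : List A} {a b} → Consec xs a b → a ∈ xs × b ∈ xs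
  Consec⇒∈ here      = here refl , there (here refl)
  Consec⇒∈ (there c) with Consec⇒∈ c
  ... | a∈ , b∈ = there a∈ , there b∈

  ∈⇒Consec : ∀ (d : A) xs {y} → y ∈ xs → ∃[ z ] Consec (xs ++ [ d ]) y z
  ∈⇒Consec d (x ∷ [])     (here refl) = d , here
  ∈⇒Consec d (x ∷ x′ ∷ xs) (here refl) = x′ , here
  ∈⇒Consec d (x ∷ xs)     (there y∈) with ∈⇒Consec d xs y∈
  ... | z , c = z , there c

  ∈-closed : ∀ {c : A} {cs y} → y ∈ c ∷ cs ++ [ c ] → y ∈ c ∷ cs
  ∈-closed          (here y≡c) = here y≡c
  ∈-closed {cs = cs} (there y∈) with ∈-++⁻ cs y∈
  ... | inj₁ y∈cs        = there y∈cs
  ... | inj₂ (here y≡c) = here y≡c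

∣tabulate∣-insert : ∀ {m} (f g : Fin m → Bool) a → f a ≡ true → g a ≡ false → (∀ i → i ≢ a → f i ≡ g i) →
  ∣ tabulate f ∣ ≡ suc ∣ tabulate g ∣
∣tabulate∣-insert f g zero    fa ga f≗g rewrite fa | ga =
  cong (suc ∘ ∣_∣) (tabulate-cong (λ i → f≗g (suc i) λ ()))
∣tabulate∣-insert f g (suc a) fa ga f≗g rewrite f≗g zero (λ ()) =
  ∷-preserves (g zero) {tabulate (f ∘ suc)} {tabulate (g ∘ suc)}
    (∣tabulate∣-insert (f ∘ suc) (g ∘ suc) a fa ga (λ i i≢a → f≗g (suc i) (i≢a ∘ Fin.suc-injective)))
  where
  ∷-preserves : ∀ {m} σ {p q : Subset m} → ∣ p ∣ ≡ suc ∣ q ∣ → ∣ σ ∷ p ∣ ≡ suc ∣ σ ∷ q ∣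
  ∷-preserves true  = cong suc
  ∷-preserves false = id

module _ {n : ℕ} where

  open import Data.List.Membership.DecPropositional (_≟_ {n = n}) using (_∈?_)

  toSubset : List (Fin n) → Subset n
  toSubset L = tabulate (λ i → does (i ∈? L))

  toSubset-∈ : ∀ {L i} → i ∈ L → lookup (toSubset L) i ≡ true
  toSubset-∈ {L} {i} i∈ = trans (lookup∘tabulate _ i) (dec-true (i ∈? L) i∈)

  toSubset-∉ : ∀ {L i} → i ∉ L → lookup (toSubset L) i ≡ false
  toSubset-∉ {L} {i} i∉ = trans (lookup∘tabulate _ i) (dec-false (i ∈? L) i∉)

  ∣toSubset∣ : (L : List (Fin n)) → Unique L → ∣ toSubset L ∣ ≡ length L
  ∣toSubset∣ []      _            =
    trans (cong ∣_∣ (trans (tabulate-cong (λ i → sym (lookup-replicate i false))) (tabulate∘lookup (∅ {n = n}))))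
          (∣⊥∣≡0 n)
  ∣toSubset∣ (a ∷ L) unique@(_ ∷ uniqueL) =
    trans (∣tabulate∣-insert _ _ a (dec-true (a ∈? a ∷ L) (here refl))
                                   (dec-false (a ∈? L) (Unique[x∷xs]⇒x∉xs unique)) others)
          (cong suc (∣toSubset∣ L uniqueL))
    where
    others : ∀ i → i ≢ a → does (i ∈? a ∷ L) ≡ does (i ∈? L)
    others i i≢a = cong (_∨ does (i ∈? L)) (dec-false (i ≟ a) i≢a)

-- Disjoint paths in a unicyclic graph

CyclesShareEdges : ∀ {n} → Graph n → Set
CyclesShareEdges G = ∀ c cs d ds → IsCycle G c cs → IsCycle G d ds →
  ∀ a b → (CycleEdge c cs a b → CycleEdge d ds a b) × (CycleEdge d ds a b → CycleEdge c cs a b)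

CycleEdge⇒∈ : ∀ {n} {c : Fin n} {cs a b} → CycleEdge c cs a b → a ∈ c ∷ cs × b ∈ c ∷ cs
CycleEdge⇒∈ (inj₁ c) with Consec⇒∈ c
... | a∈ , b∈ = ∈-closed a∈ , ∈-closed b∈
CycleEdge⇒∈ (inj₂ c) with Consec⇒∈ c
... | b∈ , a∈ = ∈-closed a∈ , ∈-closed b∈

module _ {n : ℕ} (G : Graph n) where

  open import Data.List.Membership.DecPropositional (_≟_ {n = n}) using (_∈?_)

  module _ {u v ws} (path : IsPath G u v ws) where

    source∉internal : u ∉ ws
    source∉internal u∈ = Unique[x∷xs]⇒x∉xs (proj₂ path) (∈-++⁺ˡ u∈)

    target∉internal : v ∉ ws
    target∉internal v∈ = Unique-++⇒disjoint ws (AllPairs.tail (proj₂ path)) v∈ (here refl)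

    internal-unique : Unique ws
    internal-unique = proj₁ (Unique-++⁻ ws (AllPairs.tail (proj₂ path)))

  HasDisjointPaths-≤ : ∀ {u v m m′} → HasDisjointPaths G u v m → m′ ≤ m → HasDisjointPaths G u v m′
  HasDisjointPaths-≤ (ws , paths , disjoint) m′≤m =
    ws ∘ (λ i → inject≤ i m′≤m) , paths ∘ (λ i → inject≤ i m′≤m) ,
    λ i j i≢j → disjoint _ _ (i≢j ∘ inject≤-injective m′≤m m′≤m i j)

  singlePath : ∀ {u v ws} → IsPath G u v ws → HasDisjointPaths G u v 1
  singlePath {ws = ws} path = (λ _ → ws) , (λ _ → path) , λ { zero zero 0≢0 → ⊥-elim (0≢0 refl) }

  pathPair : ∀ {u v ws₀ ws₁} → IsPath G u v ws₀ → IsPath G u v ws₁ →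
    ws₀ ≢ ws₁ → (∀ y → y ∈ ws₀ → y ∉ ws₁) → HasDisjointPaths G u v 2
  pathPair {ws₀ = ws₀} {ws₁} path₀ path₁ ws₀≢ws₁ disjoint = ws , paths , separate
    where
    ws : Fin 2 → List (Fin n)
    ws zero       = ws₀
    ws (suc zero) = ws₁
    paths : ∀ i → IsPath G _ _ (ws i)
    paths zero       = path₀
    paths (suc zero) = path₁
    separate : ∀ i j → i ≢ j → (ws i ≢ ws j) × (∀ y → y ∈ ws i → y ∉ ws j)
    separate zero       zero       i≢i = ⊥-elim (i≢i refl)
    separate zero       (suc zero) _   = ws₀≢ws₁ , disjoint
    separate (suc zero) zero       _   = ws₀≢ws₁ ∘ sym , λ y y∈₁ y∈₀ → disjoint y y∈₀ y∈₁
    separate (suc zero) (suc zero) i≢i = ⊥-elim (i≢i refl)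

  prependEdge : ∀ {u z v} → Adj G u z → z ≡ v ⊎ ∃[ ws ] IsPath G z v ws → u ≡ v ⊎ ∃[ ws ] IsPath G u v ws
  prependEdge {u} {v = v} e (inj₁ refl) with u ≟ v
  ... | yes u≡v = inj₁ u≡v
  ... | no u≢v  = inj₂ ([] , e ∷ [-] , (u≢v ∷ []) ∷ [] ∷ [])
  prependEdge {u} {z} {v} e (inj₂ (ws , walk , unique)) with u ≟ v | u ∈? z ∷ ws
  ... | yes u≡v | _      = inj₁ u≡v
  ... | no u≢v  | no u∉ = inj₂ (z ∷ ws , e ∷ walk , ¬Any⇒All¬ _ u∉′ ∷ unique)
    where
    u∉′ : u ∉ z ∷ ws ++ [ v ]
    u∉′ u∈ with ∈-++⁻ (z ∷ ws) u∈
    ... | inj₁ u∈ws        = u∉ u∈ws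
    ... | inj₂ (here u≡v) = u≢v u≡v
  ... | no _    | yes u∈ with ∈-∃++ u∈
  ...   | before , after , split =
    inj₂ (after , proj₂ (Linked-split before (subst (Linked (Adj G)) list≡ walk)) ,
                  proj₂ (Unique-++⁻ before (subst Unique list≡ unique)))
    where
    list≡ : z ∷ ws ++ [ v ] ≡ before ++ u ∷ after ++ [ v ]
    list≡ = trans (cong (_++ [ v ]) split) (++-assoc before (u ∷ after) [ v ])

  walk⇒path : ∀ {u v} ws → IsWalk G (u ∷ ws ++ [ v ]) → u ≡ v ⊎ ∃[ ws′ ] IsPath G u v ws′
  walk⇒path []       (e ∷ [-])  = prependEdge e (inj₁ refl)
  walk⇒path (z ∷ ws) (e ∷ walk) = prependEdge e (walk⇒path ws walk)

  connected⇒path : Connected G → ∀ u v → u ≢ v → HasDisjointPaths G u v 1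
  connected⇒path connected u v u≢v with connected u v u≢v
  ... | ws , walk with walk⇒path ws walk
  ...   | inj₁ u≡v          = ⊥-elim (u≢v u≡v)
  ...   | inj₂ (ws′ , path) = singlePath path

  path-reverse : ∀ {u v ws} → IsPath G v u ws → IsPath G u v (reverse ws)
  path-reverse {u} {v} {ws} (walk , unique) =
    subst (Linked (Adj G)) (reverse-∷-∷ʳ v ws u) (Linked-reverse (Adj-sym G) walk) ,
    subst Unique (reverse-∷-∷ʳ v ws u) (Unique-reverse unique)

  twoPaths⇒cycle : ∀ {u v ws₀ ws₁} → IsPath G u v ws₀ → IsPath G u v ws₁ →
    ws₀ ≢ ws₁ → (∀ y → y ∈ ws₀ → y ∉ ws₁) → IsCycle G u (ws₀ ++ v ∷ reverse ws₁)
  twoPaths⇒cycle {u} {v} {ws₀} {ws₁} path₀ path₁ ws₀≢ws₁ disjoint = long ws₀ ws₁ ws₀≢ws₁ , walk , unique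
    where
    long : ∀ ws₀ ws₁ → ws₀ ≢ ws₁ → 2 ≤ length (ws₀ ++ v ∷ reverse ws₁)
    long []            []       []≢[] = ⊥-elim ([]≢[] refl)
    long []            (w ∷ ws) _     = s≤s (subst (1 ≤_) (sym (length-reverse (w ∷ ws))) (s≤s z≤n))
    long (w ∷ [])      _        _     = s≤s (s≤s z≤n)
    long (w ∷ w′ ∷ ws) _        _     = s≤s (s≤s z≤n)
    walk : IsWalk G (u ∷ (ws₀ ++ v ∷ reverse ws₁) ++ [ u ])
    walk = subst (Linked (Adj G)) (cong (u ∷_) (sym (++-assoc ws₀ (v ∷ reverse ws₁) [ u ])))
                 (Linked-join (u ∷ ws₀) (proj₁ path₀) (proj₁ (path-reverse path₁)))
    unique : Unique (u ∷ ws₀ ++ v ∷ reverse ws₁)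
    unique = subst Unique (cong (u ∷_) (++-assoc ws₀ [ v ] (reverse ws₁)))
                   (Unique.++⁺ (proj₂ path₀) (Unique-reverse (internal-unique path₁)) separate)
      where
      separate : ∀ {y} → ¬ (y ∈ u ∷ ws₀ ++ [ v ] × y ∈ reverse ws₁)
      separate (here refl , y∈) = source∉internal path₁ (reverse⁻ y∈)
      separate (there y∈ , y∈′) with ∈-++⁻ ws₀ y∈
      ... | inj₁ y∈ws₀       = disjoint _ y∈ws₀ (reverse⁻ y∈′)
      ... | inj₂ (here refl) = target∉internal path₁ (reverse⁻ y∈′)

  cycle-rotate : ∀ {c u} P Q → IsCycle G c (P ++ u ∷ Q) → IsCycle G u (Q ++ c ∷ P)
  cycle-rotate {c} {u} P Q (long , walk , unique) =
    subst (2 ≤_) (suc-injective (↭-length (rotation c u P Q))) long , walk′ , Unique-↭ (rotation c u P Q) unique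
    where
    split : IsWalk G (c ∷ P ++ [ u ]) × IsWalk G (u ∷ Q ++ [ c ])
    split = Linked-split (c ∷ P) (subst (Linked (Adj G)) (cong (c ∷_) (++-assoc P (u ∷ Q) [ c ])) walk)
    walk′ : IsWalk G (u ∷ (Q ++ c ∷ P) ++ [ u ])
    walk′ = subst (Linked (Adj G)) (cong (u ∷_) (sym (++-assoc Q (c ∷ P) [ u ])))
                  (Linked-join (u ∷ Q) (proj₂ split) (proj₁ split))

  cycle⇒twoPaths : ∀ {u v} Q R → IsCycle G u (Q ++ v ∷ R) → HasDisjointPaths G u v 2
  cycle⇒twoPaths {u} {v} Q R (long , walk , unique@(_ ∷ unique-tail)) = pathPair forward backward distinct disjoint
    where
    split : IsWalk G (u ∷ Q ++ [ v ]) × IsWalk G (v ∷ R ++ [ u ])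
    split = Linked-split (u ∷ Q) (subst (Linked (Adj G)) (cong (u ∷_) (++-assoc Q (v ∷ R) [ u ])) walk)
    forward : IsPath G u v Q
    forward = proj₁ split ,
              proj₁ (Unique-++⁻ (u ∷ Q ++ [ v ]) (subst Unique (cong (u ∷_) (sym (++-assoc Q [ v ] R))) unique))
    backward : IsPath G u v (reverse R)
    backward = path-reverse (proj₂ split ,
      proj₁ (Unique-++⁻ (v ∷ R ++ [ u ]) (subst Unique (sym (++-assoc (v ∷ R) [ u ] Q))
                                                    (Unique-↭ (rotation u v Q R) unique))))
    disjoint : ∀ y → y ∈ Q → y ∉ reverse R
    disjoint y y∈Q y∈R = Unique-++⇒disjoint Q unique-tail y∈Q (there (reverse⁻ y∈R))
    distinct : Q ≢ reverse R
    distinct = arcs-differ Q R long disjoint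
      where
      arcs-differ : ∀ Q R → 2 ≤ length (Q ++ v ∷ R) → (∀ y → y ∈ Q → y ∉ reverse R) → Q ≢ reverse R
      arcs-differ (q ∷ Q) R _ disj Q≡ = disj q (here refl) (subst (q ∈_) Q≡ (here refl))
      arcs-differ [] [] (s≤s ()) _ _
      arcs-differ [] (r ∷ R) _ _ []≡ with trans (cong length []≡) (length-reverse (r ∷ R))
      ... | ()

  cycle-rotateTo : ∀ {c cs u} → IsCycle G c cs → u ∈ c ∷ cs →
    ∃[ cs′ ] IsCycle G u cs′ × (∀ {y} → y ∈ c ∷ cs → y ∈ u ∷ cs′)
  cycle-rotateTo {cs = cs} cycle (here refl) = cs , cycle , λ y∈ → y∈
  cycle-rotateTo {c} {u = u} cycle (there u∈) with ∈-∃++ u∈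
  ... | P , Q , refl = Q ++ c ∷ P , cycle-rotate P Q cycle , ∈-resp-↭ (rotation c u P Q)

  onCycle⇒twoPaths : ∀ {c cs u v} → IsCycle G c cs → u ∈ c ∷ cs → v ∈ c ∷ cs → u ≢ v →
    HasDisjointPaths G u v 2
  onCycle⇒twoPaths cycle u∈ v∈ u≢v with cycle-rotateTo cycle u∈
  ... | cs′ , cycle′ , moved with moved v∈
  ...   | here v≡u   = ⊥-elim (u≢v (sym v≡u))
  ...   | there v∈cs′ with ∈-∃++ v∈cs′
  ...     | Q , R , refl = cycle⇒twoPaths Q R cycle′

  module _ (share : CyclesShareEdges G) where

    cycle⊆cycle : ∀ {c cs d ds y} → IsCycle G c cs → IsCycle G d ds → y ∈ d ∷ ds → y ∈ c ∷ cs
    cycle⊆cycle {c} {cs} {d} {ds} {y} C D y∈ with ∈⇒Consec d (d ∷ ds) y∈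
    ... | z , yz = proj₁ (CycleEdge⇒∈ (proj₁ (share d ds c cs D C y z) (inj₁ yz)))

    twoPaths⇒onCycle : ∀ {c cs u v} → IsCycle G c cs → HasDisjointPaths G u v 2 → u ∈ c ∷ cs × v ∈ c ∷ cs
    twoPaths⇒onCycle {u = u} {v} C (ws , paths , separate) =
      cycle⊆cycle C D (here refl) , cycle⊆cycle C D (there (∈-++⁺ʳ (ws zero) (here refl)))
      where
      D : IsCycle G u (ws zero ++ v ∷ reverse (ws (suc zero)))
      D = twoPaths⇒cycle (paths zero) (paths (suc zero)) (proj₁ (separate zero (suc zero) λ ()))
                         (proj₂ (separate zero (suc zero) λ ()))

    private
      -- The cycles wa ∪ wb and wc ∪ wb have the same edges, yet the first edge u–w of wa lies
      -- only on the first.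
      thirdPath-absurd : ∀ {u v wa wb wc} → IsPath G u v wa → IsPath G u v wb → IsPath G u v wc →
        wa ≢ wb → wc ≢ wb → (∀ y → y ∈ wa → y ∉ wb) → (∀ y → y ∈ wc → y ∉ wb) → (∀ y → y ∈ wa → y ∉ wc) →
        wa ≢ [] → ⊥
      thirdPath-absurd {wa = []} _ _ _ _ _ _ _ _ []≢[] = []≢[] refl
      thirdPath-absurd {u} {v} {w ∷ wa} {wb} {wc} Pa Pb Pc a≢b c≢b a∉b c∉b a∉c _ =
        excluded (proj₂ (CycleEdge⇒∈ (proj₁ (share u _ u _ Ca Cc u w) (inj₁ here))))
        where
        Ca : IsCycle G u ((w ∷ wa) ++ v ∷ reverse wb)
        Ca = twoPaths⇒cycle Pa Pb a≢b a∉b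
        Cc : IsCycle G u (wc ++ v ∷ reverse wb)
        Cc = twoPaths⇒cycle Pc Pb c≢b c∉b
        excluded : w ∉ u ∷ wc ++ v ∷ reverse wb
        excluded (here w≡u) = source∉internal Pa (here (sym w≡u))
        excluded (there w∈) with ∈-++⁻ wc w∈
        ... | inj₁ w∈c          = a∉c w (here refl) w∈c
        ... | inj₂ (here w≡v)  = target∉internal Pa (here (sym w≡v))
        ... | inj₂ (there w∈b) = a∉b w (here refl) (reverse⁻ w∈b)

      thirdPath-absurdAt : ∀ {u v m} (F : HasDisjointPaths G u v m) (a b c : Fin m) →
        a ≢ b → c ≢ b → a ≢ c → proj₁ F a ≢ [] → ⊥
      thirdPath-absurdAt (_ , paths , separate) a b c a≢b c≢b a≢c =
        thirdPath-absurd (paths a) (paths b) (paths c)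
          (proj₁ (separate a b a≢b)) (proj₁ (separate c b c≢b))
          (proj₂ (separate a b a≢b)) (proj₂ (separate c b c≢b)) (proj₂ (separate a c a≢c))

    ¬threePaths : ∀ {u v} → ¬ HasDisjointPaths G u v 3
    ¬threePaths F@(ws , _ , separate) with ws zero in ws₀≡
    ... | []    = thirdPath-absurdAt F (suc zero) zero (suc (suc zero)) (λ ()) (λ ()) (λ ())
                    (λ ws₁≡[] → proj₁ (separate zero (suc zero) (λ ())) (trans ws₀≡ (sym ws₁≡[])))
    ... | _ ∷ _ = thirdPath-absurdAt F zero (suc zero) (suc (suc zero)) (λ ()) (λ ()) (λ ())
                    (λ ws₀≡[] → case trans (sym ws₀≡) ws₀≡[] of λ ())

  HasDisjointPaths-bound : ∀ {u v m} k → ¬ HasDisjointPaths G u v (suc k) → HasDisjointPaths G u v m → m ≤ k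
  HasDisjointPaths-bound {m = m} k none family with m ≤? k
  ... | yes m≤k = m≤k
  ... | no m≰k  = ⊥-elim (none (HasDisjointPaths-≤ family (≰⇒> m≰k)))

  module _ (connected : Connected G) (share : CyclesShareEdges G) {c cs} (C : IsCycle G c cs)
           (M : Fin n → Fin n → ℕ) (isPathMatrix : IsPathMatrix G M) where

    pathMatrix-onCycle : ∀ {i j} → i ∈ c ∷ cs → j ∈ c ∷ cs → i ≢ j → M i j ≡ 2
    pathMatrix-onCycle {i} {j} i∈ j∈ i≢j with proj₂ (isPathMatrix i j) i≢j
    ... | family , maximal =
      ≤-antisym (HasDisjointPaths-bound 2 (¬threePaths share) family) (maximal 2 (onCycle⇒twoPaths C i∈ j∈ i≢j))

    pathMatrix-offCycle : ∀ {i j} → ¬ (i ∈ c ∷ cs × j ∈ c ∷ cs) → i ≢ j → M i j ≡ 1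
    pathMatrix-offCycle {i} {j} ¬both i≢j with proj₂ (isPathMatrix i j) i≢j
    ... | family , maximal =
      ≤-antisym (HasDisjointPaths-bound 1 (¬both ∘ twoPaths⇒onCycle share C) family)
                (maximal 1 (connected⇒path connected i j i≢j))

    pathMatrix-offDiagonal : ∀ i j → i ≢ j →
      M i j ≡ pathCount (lookup (toSubset (c ∷ cs)) i) (lookup (toSubset (c ∷ cs)) j)
    pathMatrix-offDiagonal i j i≢j with i ∈? c ∷ cs | j ∈? c ∷ cs
    ... | yes i∈ | yes j∈ = trans (pathMatrix-onCycle i∈ j∈ i≢j)
                                  (sym (cong₂ pathCount (toSubset-∈ i∈) (toSubset-∈ j∈)))
    ... | yes i∈ | no j∉  = trans (pathMatrix-offCycle (j∉ ∘ proj₂) i≢j)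
                                  (sym (cong₂ pathCount (toSubset-∈ i∈) (toSubset-∉ j∉)))
    ... | no i∉  | _      = trans (pathMatrix-offCycle (i∉ ∘ proj₁) i≢j)
                                  (sym (cong (λ σ → pathCount σ (lookup (toSubset (c ∷ cs)) j)) (toSubset-∉ i∉)))

theorem4 : (n k : ℕ) → 3 ≤ k → k < n →
    (G : Graph n) → UnicyclicWithCycleLength G k →
    (M : Fin n → Fin n → ℕ) → IsPathMatrix G M →
    (x : ℤ) →
    det n (charMat n x M)
      ≡ ((x + + 2) ^ (k Data.Nat.∸ 1)) * ((x + + 1) ^ (n Data.Nat.∸ k Data.Nat.∸ 1))
        * (x * x - (+ n + + k - + 3) * x
             - (+ k * + k - + n * + k + + 2 * + n - + 2))
theorem4 n k 3≤k k<n G (connected , (c , cs , C , length≡k) , share) M isPathMatrix x = begin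
  det n (charMat n x M)  ≡⟨ det-cong (charMat≗typeMatrix M v zeroDiagonal offDiagonal) ⟩
  det n (typeMatrix v)   ≡⟨ det-typeMatrix v ⟩
  χ ∣ v ∣ (∣ ∁ v ∣)       ≡⟨ cong₂ χ ∣v∣≡k (trans (∣∁p∣≡n∸∣p∣ v) (cong (n ∸_) ∣v∣≡k)) ⟩
  χ k (n ∸ k)            ≡⟨ χ-factorisation n k (≤-trans (s≤s (z≤n {2})) 3≤k) k<n ⟩
  p ^ (k ∸ 1) * q ^ (n ∸ k ∸ 1) * quadratic n k ∎
  where
  open ≡-Reasoning
  open TypeMatrix x
  v : Subset n
  v = toSubset (c ∷ cs)
  zeroDiagonal : ∀ i → M i i ≡ 0
  zeroDiagonal i = proj₁ (isPathMatrix i i) refl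
  offDiagonal : ∀ i j → i ≢ j → M i j ≡ pathCount (lookup v i) (lookup v j)
  offDiagonal = pathMatrix-offDiagonal G connected share C M isPathMatrix
  ∣v∣≡k : ∣ v ∣ ≡ k
  ∣v∣≡k = trans (∣toSubset∣ (c ∷ cs) (proj₂ (proj₂ C))) length≡k
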